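{- Let $G$ be an abelian group of odd order and let $\{A,B,C\}$ be a rainbow-free $3$-coloring of $G$ with non-empty color classes. If $|A|=1$, then the coloring is $H$-regular with $H=\{0\}$.
   Context: A $3$-term arithmetic progression is a triple $(x,y,z)\in G^3$ with $x+y=2z$; it is rainbow if its members lie in pairwise distinct color classes; a coloring is rainbow-free if there is none. A set $S$ is $H$-periodic if $S+H=S$; $2\cdot X=\{2x:x\in X\}$, $-X=\{ -x\}$. For a subgroup $H$ of $G$ (here proper subgroups, including $\{0\}$), the coloring is called $H$-regular if there exist $g\in G$ and a labelling $A',B',C'$ of the color classes of the translated coloring $x\mapsto c(x+g)$ such that: (i) $A'\subseteq H$ and the coloring induced on $H$ is rainbow-free; (ii) $B'\setminus H$ and $C'\setminus H$ are $H$-periodic; (iii) $\widetilde B=B'\setminus H$ and $\widetilde C=C'\setminus H$ satisfy $\widetilde{B}=-\widetilde{B}=2\cdot\widetilde{B}$ and $\widetilde{C}=-\widetilde{C}=2\cdot\widetilde{C}$. -}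

module Defs where

open import Level using (Level; _⊔_)
open import Data.Nat using (ℕ; suc; _*_)
open import Data.Fin using (Fin)
open import Data.Product using (Σ; ∃; _×_; _,_)
open import Relation.Nullary using (¬_)
open import Relation.Binary.PropositionalEquality using (_≡_)
open import Relation.Unary using (Pred)
open import Algebra.Bundles using (AbelianGroup)

Odd : ℕ → Set
Odd n = ∃ λ k → n ≡ suc (2 * k)

module _ {c ℓ : Level} (G : AbelianGroup c ℓ) where
  open AbelianGroup G renaming (Carrier to X)

  HasOrder : ℕ → Set (c ⊔ ℓ)
  HasOrder n = Σ (Fin n → X) λ e →
                 ((i j : Fin n) → e i ≈ e j → i ≡ j) × ((x : X) → ∃ λ i → e i ≈ x)

  Coloring : Set (c ⊔ ℓ)
  Coloring = Σ (X → Fin 3) λ col → ∀ {x y} → x ≈ y → col x ≡ col y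

  Distinct3 : {A : Set} → A → A → A → Set
  Distinct3 a b d = ¬ (a ≡ b) × ¬ (a ≡ d) × ¬ (b ≡ d)

  -- rainbow 3-term AP (x , y , z) with x + y = 2z, all of whose members lie in S
  RainbowAPIn : ∀ {p} → Pred X p → (X → Fin 3) → Set (c ⊔ ℓ ⊔ p)
  RainbowAPIn S col = ∃ λ x → ∃ λ y → ∃ λ z →
    S x × S y × S z × (x ∙ y ≈ z ∙ z) × Distinct3 (col x) (col y) (col z)

  Everything : Pred X Level.zero
  Everything _ = Data.Unit.⊤
    where import Data.Unit

  RainbowFree : (X → Fin 3) → Set (c ⊔ ℓ)
  RainbowFree col = ¬ RainbowAPIn Everything col

  Class : (X → Fin 3) → Fin 3 → Pred X Level.zero
  Class col k x = col x ≡ k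

  _⊆_ : ∀ {p q} → Pred X p → Pred X q → Set (c ⊔ p ⊔ q)
  S ⊆ T = ∀ x → S x → T x

  _≐_ : ∀ {p q} → Pred X p → Pred X q → Set (c ⊔ p ⊔ q)
  S ≐ T = (S ⊆ T) × (T ⊆ S)

  _∖_ : ∀ {p q} → Pred X p → Pred X q → Pred X (p ⊔ q)
  (S ∖ T) x = S x × ¬ T x

  _⊕_ : ∀ {p q} → Pred X p → Pred X q → Pred X (c ⊔ ℓ ⊔ p ⊔ q)
  (S ⊕ T) y = ∃ λ s → ∃ λ t → S s × T t × (y ≈ s ∙ t)

  neg : ∀ {p} → Pred X p → Pred X (c ⊔ ℓ ⊔ p)
  neg S y = ∃ λ x → S x × (y ≈ x ⁻¹)

  dbl : ∀ {p} → Pred X p → Pred X (c ⊔ ℓ ⊔ p)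
  dbl S y = ∃ λ x → S x × (y ≈ x ∙ x)

  Periodic : ∀ {p q} → Pred X q → Pred X p → Set (c ⊔ ℓ ⊔ p ⊔ q)
  Periodic H S = (S ⊕ H) ≐ S

  IsRegular : ∀ {q} → Pred X q → (X → Fin 3) → Set (c ⊔ ℓ ⊔ q)
  IsRegular H col = ∃ λ g →
    let col' = λ x → col (x ∙ g) in
    ∃ λ a → ∃ λ b → ∃ λ d → Distinct3 a b d ×
      (let A' = Class col' a ; B' = Class col' b ; C' = Class col' d
           B~ = B' ∖ H ; C~ = C' ∖ H in
        ((A' ⊆ H) × ¬ RainbowAPIn H col')
      × (Periodic H B~ × Periodic H C~)
      × ((B~ ≐ neg B~) × (B~ ≐ dbl B~))
      × ((C~ ≐ neg C~) × (C~ ≐ dbl C~)))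

  Zero : Pred X ℓ
  Zero x = x ≈ ε

-- Translate the coloring so that the singleton class A becomes {0}.  For
-- x ≠ 0 the progressions (x, −x, 0) and (0, 2x, x) contain 0, the only point of
-- colour A, so rainbow-freeness forces x, −x and 2x to share a colour.  Hence
-- B ∖ {0} and C ∖ {0} are closed under negation and doubling; since the order
-- n = 2k + 1 kills every element, (k + 1)·y halves y, so doubling is onto as
-- well, and x + x = 0 only for x = 0.  {0}-periodicity is automatic.
module Submission where

open import Defs
open import Level using (Level)
open import Data.Nat using (ℕ)
open import Data.Fin using (Fin)
open import Data.Product using (∃; _×_; proj₁)
open import Relation.Binary.PropositionalEquality using (_≡_)
open import Algebra.Bundles using (AbelianGroup)

open import Function using (_∘_)
open import Data.Nat as ℕ using ()
open import Data.Nat.Properties using (+-suc; +-identityʳ)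
open import Data.Fin using (zero; suc; _≟_)
open import Data.Fin.Permutation using (Permutation; permutation; _⟨$⟩ʳ_)
open import Data.Product using (_,_; ∃₂; proj₂)
open import Data.Unit using (tt)
open import Relation.Unary using (Pred)
open import Data.Empty using (⊥-elim)
open import Relation.Nullary using (¬_; yes; no)
open import Relation.Binary.PropositionalEquality using (_≢_)
import Relation.Binary.PropositionalEquality as ≡

Pairwise≢ : Fin 3 → Fin 3 → Fin 3 → Set
Pairwise≢ p q r = p ≢ q × p ≢ r × q ≢ r

Pairwise≢-rotate : ∀ {p q r} → Pairwise≢ p q r → Pairwise≢ r p q
Pairwise≢-rotate (p≢q , p≢r , q≢r) = p≢r ∘ ≡.sym , q≢r ∘ ≡.sym , p≢q

other-two : (a : Fin 3) → ∃₂ λ b d → Pairwise≢ a b d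
other-two zero             = suc zero , suc (suc zero) , (λ ()) , (λ ()) , (λ ())
other-two (suc zero)       = zero , suc (suc zero) , (λ ()) , (λ ()) , (λ ())
other-two (suc (suc zero)) = zero , suc zero , (λ ()) , (λ ()) , (λ ())

≡-unless-Pairwise≢ : ∀ {p q r} → p ≢ r → q ≢ r → ¬ Pairwise≢ p q r → p ≡ q
≡-unless-Pairwise≢ {p} {q} p≢r q≢r not-pairwise with p ≟ q
... | yes p≡q = p≡q
... | no  p≢q = ⊥-elim (not-pairwise (p≢q , p≢r , q≢r))

2+2k≡[1+k]+[1+k] : ∀ k → 2 ℕ.+ 2 ℕ.* k ≡ ℕ.suc k ℕ.+ ℕ.suc k
2+2k≡[1+k]+[1+k] k = ≡.cong ℕ.suc (≡.sym (begin
  k ℕ.+ ℕ.suc k        ≡⟨ +-suc k k ⟩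
  ℕ.suc (k ℕ.+ k)      ≡⟨ ≡.cong (ℕ.suc ∘ (k ℕ.+_)) (+-identityʳ k) ⟨
  ℕ.suc (2 ℕ.* k)      ∎))
  where open ≡.≡-Reasoning

module _ {c ℓ} (G : AbelianGroup c ℓ) where
  open AbelianGroup G renaming (Carrier to X)
  open import Algebra.Properties.Group group
    using (identityˡ-unique; identityʳ-unique; ⁻¹-involutive; ⁻¹-injective; ε⁻¹≈ε)
  open import Algebra.Properties.CommutativeSemigroup commutativeSemigroup using (interchange)
  open import Algebra.Properties.CommutativeMonoid.Sum commutativeMonoid
    using (sum; sum-permute; sum-cong-≋; ∑-distrib-+; sum-replicate)
  open import Algebra.Properties.Monoid.Mult monoid using (×-congʳ; ×-congˡ; ×-homo-+; ×-idem)
    renaming (_×_ to _·_)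
  open import Algebra.Properties.CommutativeMonoid.Mult commutativeMonoid using (×-distrib-+)
  open import Relation.Binary.Reasoning.Setoid setoid

  translation : ∀ {n} → HasOrder G n → X → Permutation n n
  translation {n} (e , e-injective , e-surjective) y =
    permutation (shift y) (shift (y ⁻¹)) (cancels (inverseˡ y)) (cancels (inverseʳ y))
    where
    shift : X → Fin n → Fin n
    shift y i = proj₁ (e-surjective (e i ∙ y))

    cancels : ∀ {y z} → z ∙ y ≈ ε → ∀ i → shift y (shift z i) ≡ i
    cancels {y} {z} zy≈ε i = e-injective _ _ (begin
      e (shift y (shift z i)) ≈⟨ proj₂ (e-surjective _) ⟩
      e (shift z i) ∙ y       ≈⟨ ∙-congʳ (proj₂ (e-surjective _)) ⟩
      (e i ∙ z) ∙ y           ≈⟨ assoc _ _ _ ⟩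
      e i ∙ (z ∙ y)           ≈⟨ ∙-congˡ zy≈ε ⟩
      e i ∙ ε                 ≈⟨ identityʳ _ ⟩
      e i                     ∎)

  -- Translation by y permutes G, so adding y to every term fixes the sum of all elements.
  order-annihilates : ∀ {n} → HasOrder G n → ∀ y → n · y ≈ ε
  order-annihilates {n} ord@(e , _ , e-surjective) y = identityʳ-unique (sum e) (n · y) (begin
    sum e ∙ n · y                        ≈⟨ ∙-congˡ (sum-replicate n) ⟨
    sum e ∙ sum {n} (λ _ → y)            ≈⟨ ∑-distrib-+ e (λ _ → y) ⟨
    sum (λ i → e i ∙ y)                  ≈⟨ sum-cong-≋ (λ i → proj₂ (e-surjective (e i ∙ y))) ⟨
    sum (e ∘ (translation ord y ⟨$⟩ʳ_))  ≈⟨ sum-permute e (translation ord y) ⟨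
    sum e                                ∎)

  module OddOrder {n k : ℕ} (n≡1+2k : n ≡ ℕ.suc (2 ℕ.* k)) (ord : HasOrder G n) where

    half : X → X
    half y = ℕ.suc k · y

    half-doubles : ∀ y → half y ∙ half y ≈ y
    half-doubles y = begin
      half y ∙ half y                  ≈⟨ ×-homo-+ y (ℕ.suc k) (ℕ.suc k) ⟨
      (ℕ.suc k ℕ.+ ℕ.suc k) · y        ≈⟨ ×-congˡ (2+2k≡[1+k]+[1+k] k) ⟨
      y ∙ ℕ.suc (2 ℕ.* k) · y          ≈⟨ ∙-congˡ (×-congˡ n≡1+2k) ⟨
      y ∙ n · y                        ≈⟨ ∙-congˡ (order-annihilates ord y) ⟩
      y ∙ ε                            ≈⟨ identityʳ y ⟩
      y                                ∎

    half-square : ∀ x → half (x ∙ x) ≈ x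
    half-square x = trans (×-distrib-+ x x (ℕ.suc k)) (half-doubles x)

    square≈ε⇒≈ε : ∀ {x} → x ∙ x ≈ ε → x ≈ ε
    square≈ε⇒≈ε {x} xx≈ε = begin
      x              ≈⟨ half-square x ⟨
      half (x ∙ x)   ≈⟨ ×-congʳ (ℕ.suc k) xx≈ε ⟩
      half ε         ≈⟨ ×-idem (identityˡ ε) (ℕ.suc k) ⟩
      ε              ∎

  Respects≈ : (X → Fin 3) → Set (c Level.⊔ ℓ)
  Respects≈ col = ∀ {x y} → x ≈ y → col x ≡ col y

  translate-RainbowFree : ∀ {col} g → RainbowFree G col → RainbowFree G (λ x → col (x ∙ g))
  translate-RainbowFree g rainbow-free (x , y , z , _ , _ , _ , xy≈zz , rainbow) =
    rainbow-free (x ∙ g , y ∙ g , z ∙ g , tt , tt , tt , shifted , rainbow)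
    where
    shifted : (x ∙ g) ∙ (y ∙ g) ≈ (z ∙ g) ∙ (z ∙ g)
    shifted = begin
      (x ∙ g) ∙ (y ∙ g)  ≈⟨ interchange x g y g ⟩
      (x ∙ y) ∙ (g ∙ g)  ≈⟨ ∙-congʳ xy≈zz ⟩
      (z ∙ z) ∙ (g ∙ g)  ≈⟨ interchange z z g g ⟩
      (z ∙ g) ∙ (z ∙ g)  ∎

  translate-singleton : ∀ {col : X → Fin 3} {a g} →
                        (∀ y → col y ≡ a → y ≈ g) → ∀ x → col (x ∙ g) ≡ a → x ≈ ε
  translate-singleton only-g x colour≡a = identityˡ-unique x _ (only-g _ colour≡a)

  ⁻¹≈ε⇒≈ε : ∀ {x} → x ⁻¹ ≈ ε → x ≈ ε
  ⁻¹≈ε⇒≈ε x⁻¹≈ε = ⁻¹-injective (trans x⁻¹≈ε (sym ε⁻¹≈ε))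

  Zero-periodic : ∀ {p} {S : Pred X p} → (∀ {x y} → x ≈ y → S x → S y) → Periodic G (Zero G) S
  Zero-periodic S-resp =
      (λ y (s , t , s∈S , t≈ε , y≈s∙t) → S-resp (sym (trans y≈s∙t (trans (∙-congˡ t≈ε) (identityʳ s)))) s∈S)
    , (λ y y∈S → y , ε , y∈S , refl , sym (identityʳ y))

  no-rainbow-in-Zero : ∀ {col} → Respects≈ col → ¬ RainbowAPIn G (Zero G) col
  no-rainbow-in-Zero col-resp (x , y , _ , x≈ε , y≈ε , _ , _ , colx≢coly , _) =
    colx≢coly (≡.trans (col-resp x≈ε) (≡.sym (col-resp y≈ε)))

  module PuncturedClasses
    (col : X → Fin 3) (col-resp : Respects≈ col) (rainbow-free : RainbowFree G col)
    (a : Fin 3) (col-ε : col ε ≡ a) (only-ε : ∀ x → col x ≡ a → x ≈ ε)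
    (half : X → X) (half-doubles : ∀ y → half y ∙ half y ≈ y)
    (square≈ε⇒≈ε : ∀ {x} → x ∙ x ≈ ε → x ≈ ε)
    where

    ap-not-rainbow : ∀ {x y z} → x ∙ y ≈ z ∙ z → ¬ Pairwise≢ (col x) (col y) (col z)
    ap-not-rainbow xy≈zz rainbow = rainbow-free (_ , _ , _ , tt , tt , tt , xy≈zz , rainbow)

    ≉ε⇒colour≢ : ∀ {x} → ¬ x ≈ ε → col x ≢ col ε
    ≉ε⇒colour≢ {x} x≉ε colx≡colε = x≉ε (only-ε x (≡.trans colx≡colε col-ε))

    colour-⁻¹ : ∀ {x} → ¬ x ≈ ε → col (x ⁻¹) ≡ col x
    colour-⁻¹ {x} x≉ε = ≡.sym (≡-unless-Pairwise≢ (≉ε⇒colour≢ x≉ε) (≉ε⇒colour≢ (x≉ε ∘ ⁻¹≈ε⇒≈ε))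
      (ap-not-rainbow (trans (inverseʳ x) (sym (identityˡ ε)))))

    colour-square : ∀ {x} → ¬ x ≈ ε → col (x ∙ x) ≡ col x
    colour-square x≉ε = ≡-unless-Pairwise≢ (≉ε⇒colour≢ (x≉ε ∘ square≈ε⇒≈ε)) (≉ε⇒colour≢ x≉ε)
      (ap-not-rainbow (identityˡ _) ∘ Pairwise≢-rotate)

    Punctured : Fin 3 → Pred X ℓ
    Punctured b = _∖_ G (Class G col b) (Zero G)

    module _ {b : Fin 3} where

      Punctured-resp : ∀ {x y} → x ≈ y → Punctured b x → Punctured b y
      Punctured-resp x≈y (colx≡b , x≉ε) = ≡.trans (col-resp (sym x≈y)) colx≡b , x≉ε ∘ trans x≈y

      Punctured-⁻¹ : ∀ {x} → Punctured b x → Punctured b (x ⁻¹)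
      Punctured-⁻¹ (colx≡b , x≉ε) = ≡.trans (colour-⁻¹ x≉ε) colx≡b , x≉ε ∘ ⁻¹≈ε⇒≈ε

      Punctured-square : ∀ {x} → Punctured b x → Punctured b (x ∙ x)
      Punctured-square (colx≡b , x≉ε) = ≡.trans (colour-square x≉ε) colx≡b , x≉ε ∘ square≈ε⇒≈ε

      Punctured-half : ∀ {y} → Punctured b y → Punctured b (half y)
      Punctured-half {y} (coly≡b , y≉ε) =
        ≡.trans (≡.sym (colour-square half≉ε)) (≡.trans (col-resp (half-doubles y)) coly≡b) , half≉ε
        where
        half≉ε : ¬ half y ≈ ε
        half≉ε half≈ε = y≉ε (trans (sym (half-doubles y)) (trans (∙-cong half≈ε half≈ε) (identityˡ ε)))

      Punctured-neg : _≐_ G (Punctured b) (neg G (Punctured b))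
      Punctured-neg =
          (λ y y∈B → y ⁻¹ , Punctured-⁻¹ y∈B , sym (⁻¹-involutive y))
        , (λ y (x , x∈B , y≈x⁻¹) → Punctured-resp (sym y≈x⁻¹) (Punctured-⁻¹ x∈B))

      Punctured-dbl : _≐_ G (Punctured b) (dbl G (Punctured b))
      Punctured-dbl =
          (λ y y∈B → half y , Punctured-half y∈B , sym (half-doubles y))
        , (λ y (x , x∈B , y≈x∙x) → Punctured-resp (sym y≈x∙x) (Punctured-square x∈B))

lemma3 : ∀ {c ℓ} (G : AbelianGroup c ℓ) (n : ℕ) → Odd n → HasOrder G n →
    (κ : Coloring G) →
    RainbowFree G (proj₁ κ) →
    (∀ (k : Fin 3) → ∃ λ x → proj₁ κ x ≡ k) →
    (∃ λ (a : Fin 3) → ∃ λ x → proj₁ κ x ≡ a × (∀ y → proj₁ κ y ≡ a → AbelianGroup._≈_ G y x)) →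
    IsRegular G (Zero G) (proj₁ κ)
lemma3 G n (k , n≡1+2k) ord (col , col-resp) rainbow-free _ (a , g , colg≡a , only-g) =
  g , a , b , d , a-b-d ,
  (translate-singleton G only-g , no-rainbow-in-Zero G col′-resp) ,
  (Zero-periodic G Punctured-resp , Zero-periodic G Punctured-resp) ,
  (Punctured-neg , Punctured-dbl) ,
  (Punctured-neg , Punctured-dbl)
  where
  open AbelianGroup G using (Carrier; _∙_; identityˡ; ∙-congʳ)
  open OddOrder G {k = k} n≡1+2k ord

  col′ : Carrier → Fin 3
  col′ x = col (x ∙ g)

  col′-resp : Respects≈ G col′
  col′-resp = col-resp ∘ ∙-congʳ

  open PuncturedClasses G col′ col′-resp (translate-RainbowFree G g rainbow-free)
    a (≡.trans (col-resp (identityˡ g)) colg≡a) (translate-singleton G only-g)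
    half half-doubles square≈ε⇒≈ε

  b d : Fin 3
  b = proj₁ (other-two a)
  d = proj₁ (proj₂ (other-two a))

  a-b-d : Pairwise≢ a b d
  a-b-d = proj₂ (proj₂ (other-two a))
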